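{- Let $s$ be a composition. The $h$-polynomial of the combinatorial $s$-permutahedron is $A_s(x)=\sum_{k\ge0}|\mathcal W_s(k)|\,x^k$, where $\mathcal W_s(k)$ is the set of Stirling $s$-permutations with exactly $k$ descents.
   Context: $s=(s_1,\dots,s_n)$ is a composition. Stirling $s$-permutation: word with each $i\in[n]$ occurring $s_i$ times, avoiding $121$. For $1\le a<c\le n$, $(a,c)$ is an ascent of $w$ if $ac$ is a consecutive substring and a descent if $ca$ is a consecutive substring. The combinatorial $s$-permutahedron has as faces the pairs $(w,A)$ with $w$ a Stirling $s$-permutation and $A$ a subset of ascents of $w$; the face $(w,A)$ has dimension $|A|$. Its $f$-polynomial is $f(x)=\sum_{(w,A)}x^{|A|}$, and its $h$-polynomial is defined by $f(x)=h(x+1)$. -}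

module Defs where

open import Data.Nat using (ℕ; zero; suc; _+_; _*_; _<ᵇ_; _≡ᵇ_)
open import Data.Bool using (Bool; true; false; _∧_; _∨_; not; if_then_else_)
open import Data.Nat.ListAction using (sum)
open import Data.List using (List; []; _∷_; length; map; filter; upTo; _++_; concatMap; foldr)
open import Data.List.Relation.Unary.All using (All)
open import Data.Product using (_×_; _,_; proj₂)
open import Data.Nat using (_≤_)
open import Relation.Nullary.Decidable using (Dec; yes; no)
open import Relation.Binary.PropositionalEquality using (_≡_)

-- A word is a list of letters; letters are the naturals 1,…,n.
Word : Set
Word = List ℕ

IsComposition : List ℕ → Set
IsComposition s = All (λ x → 1 ≤ x) s

occ : ℕ → Word → ℕ
occ a []       = 0
occ a (x ∷ xs) = if a ≡ᵇ x then suc (occ a xs) else occ a xs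

elemᵇ : ℕ → Word → Bool
elemᵇ a []       = false
elemᵇ a (x ∷ xs) = (a ≡ᵇ x) ∨ elemᵇ a xs

bigThen : ℕ → Word → Bool
bigThen x []       = false
bigThen x (y ∷ ys) = ((x <ᵇ y) ∧ elemᵇ x ys) ∨ bigThen x ys

-- w contains the pattern 121: a subsequence a c a with a < c
contains121 : Word → Bool
contains121 []       = false
contains121 (x ∷ xs) = bigThen x xs ∨ contains121 xs

-- each letter i ∈ [n] (i = 1,…,n) occurs exactly sᵢ times, letter i given by offset
multOK : ℕ → List ℕ → Word → Bool
multOK i []       w = true
multOK i (m ∷ ms) w = (occ i w ≡ᵇ m) ∧ multOK (suc i) ms w

letters : ℕ → List ℕ
letters n = map suc (upTo n)

allWords : ℕ → ℕ → List Word
allWords n zero    = [] ∷ []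
allWords n (suc N) = concatMap (λ a → map (a ∷_) (allWords n N)) (letters n)

isStirling : List ℕ → Word → Bool
isStirling s w = multOK 1 s w ∧ not (contains121 w)

Stirling : List ℕ → List Word
Stirling s = filter (λ w → Data.Bool._≟_ (isStirling s w) true) (allWords (length s) (sum s))
  where import Data.Bool

pairEq : ℕ × ℕ → ℕ × ℕ → Bool
pairEq (a , b) (c , d) = (a ≡ᵇ c) ∧ (b ≡ᵇ d)

memPair : ℕ × ℕ → List (ℕ × ℕ) → Bool
memPair p []       = false
memPair p (q ∷ qs) = pairEq p q ∨ memPair p qs

dedup : List (ℕ × ℕ) → List (ℕ × ℕ)
dedup []       = []
dedup (p ∷ ps) = if memPair p ps then dedup ps else p ∷ dedup ps

-- consecutive pairs a c with a < c (ascent (a,c)), resp. c a (descent (a,c))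
ascList : Word → List (ℕ × ℕ)
ascList []           = []
ascList (x ∷ [])     = []
ascList (x ∷ y ∷ ys) = if x <ᵇ y then (x , y) ∷ ascList (y ∷ ys) else ascList (y ∷ ys)

descList : Word → List (ℕ × ℕ)
descList []           = []
descList (x ∷ [])     = []
descList (x ∷ y ∷ ys) = if y <ᵇ x then (y , x) ∷ descList (y ∷ ys) else descList (y ∷ ys)

ascents : Word → List (ℕ × ℕ)
ascents w = dedup (ascList w)

descents : Word → List (ℕ × ℕ)
descents w = dedup (descList w)

subsets : {A : Set} → List A → List (List A)
subsets []       = [] ∷ []
subsets (x ∷ xs) = subsets xs ++ map (x ∷_) (subsets xs)

-- faces (w , A) of the combinatorial s-permutahedron
faces : List ℕ → List (Word × List (ℕ × ℕ))
faces s = concatMap (λ w → map (w ,_) (subsets (ascents w))) (Stirling s)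

-- j-th coefficient of the f-polynomial: number of faces of dimension j
fCoeff : List ℕ → ℕ → ℕ
fCoeff s j = length (filter (λ F → Data.Nat._≟_ (length (proj₂ F)) j) (faces s))
  where import Data.Nat

W : List ℕ → ℕ → List Word
W s k = filter (λ w → Data.Nat._≟_ (length (descents w)) k) (Stirling s)
  where import Data.Nat

-- A Stirling s-permutation w carries exactly the faces (w , A) with A ⊆ asc(w), so
-- [xʲ] f = Σ_w (|asc w| choose j); that is, f(x) = Σ_w (1+x)^|asc w| and h(x) = Σ_w x^|asc w|.
-- Reversal is an involution on Stirling s-permutations (it keeps the multiplicities, and the
-- pattern 121 is its own reverse) that turns ascents into descents, so h(x) = Σ_w x^|des w|;
-- grouping the words by their number of descents gives A_s(x).
{-# OPTIONS --safe #-}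
module Submission where

open import Defs
open import Algebra.Bundles using (CommutativeMonoid)
open import Data.Bool using (Bool; true; false; T; if_then_else_; _∧_; _∨_; not)
import Data.Bool as Bool
open import Data.Bool.Properties using (T-∨; T-∧; T-≡; ¬-not; ∨-commutativeMonoid)
open import Data.Empty using (⊥-elim)
open import Data.List
  using (List; []; _∷_; [_]; _++_; length; map; filter; concatMap; reverse; upTo)
open import Data.List.Membership.Propositional using (_∈_; _∉_)
open import Data.List.Membership.Propositional.Properties using (∈-upTo⁺)
open import Data.List.Properties
  using (map-++; map-cong; map-∘; unfold-reverse; reverse-++; length-map; length-filter; filter-++)
open import Data.List.Relation.Binary.Permutation.Propositional as ↭ using (_↭_)
open import Data.List.Relation.Binary.Permutation.Propositional.Properties using (↭-reverse)
open import Data.List.Relation.Binary.Sublist.Propositional using (_⊆_; _∷_; _∷ʳ_; from∈; to∈)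
open import Data.List.Relation.Binary.Sublist.Propositional.Properties using (reverse⁺; reverse⁻)
open import Data.List.Relation.Unary.All as All using (All; []; _∷_)
open import Data.List.Relation.Unary.All.Properties using (concat⁺; map⁺; filter⁺; All¬⇒¬Any)
open import Data.List.Relation.Unary.Any as Any using (here; there)
open import Data.List.Relation.Unary.AllPairs using (_∷_)
open import Data.List.Relation.Unary.Unique.Propositional using (Unique)
open import Data.List.Relation.Unary.Unique.Propositional.Properties using (upTo⁺)
open import Data.Nat using (ℕ; zero; suc; pred; _+_; _*_; _≤_; _<_; z≤n; s≤s; _≟_; _<?_; _≡ᵇ_; _<ᵇ_)
open import Data.Nat.Combinatorics using (_C_; nCk+nC[k+1]≡[n+1]C[k+1])
open import Data.Nat.ListAction using (sum)
open import Data.Nat.ListAction.Properties using (sum-++)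
open import Data.Nat.Properties
  using (+-comm; +-identityʳ; n≤1+n; ≤-trans; ≤-reflexive; pred[n]≤n; ≡ᵇ⇒≡; ≡⇒≡ᵇ; <ᵇ⇒<; <⇒<ᵇ;
         +-commutativeSemigroup; module ≤-Reasoning)
open import Data.Product using (_×_; _,_; proj₁; proj₂; ∃-syntax; ∃₂; swap)
import Data.Product.Properties as Product
open import Data.Sum using (inj₁; inj₂)
open import Function using (_∘_; _⇔_; mk⇔; Equivalence)
open import Level using (0ℓ)
open import Relation.Binary.PropositionalEquality
  using (_≡_; _≢_; refl; sym; trans; cong; cong₂; _≗_; module ≡-Reasoning)
open import Relation.Nullary using (Dec; yes; no; does)
open import Relation.Nullary.Decidable using (dec-true; dec-false)
open import Relation.Unary using (Pred; Decidable)

open import Algebra.Properties.CommutativeSemigroup +-commutativeSemigroup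
  using () renaming (interchange to +-interchange; x∙yz≈y∙xz to +-leftComm)
open import Algebra.Properties.CommutativeSemigroup
    (CommutativeMonoid.commutativeSemigroup ∨-commutativeMonoid)
  using () renaming (x∙yz≈y∙xz to ∨-leftComm)

private
  variable
    A B : Set

∑ : (A → ℕ) → List A → ℕ
∑ f xs = sum (map f xs)

𝟙 : {P : Pred A 0ℓ} → Decidable P → A → ℕ
𝟙 P? x = if does (P? x) then 1 else 0

∑-++ : (f : A → ℕ) (xs ys : List A) → ∑ f (xs ++ ys) ≡ ∑ f xs + ∑ f ys
∑-++ f xs ys = trans (cong sum (map-++ f xs ys)) (sum-++ (map f xs) (map f ys))

∑-map : (f : B → ℕ) (g : A → B) (xs : List A) → ∑ f (map g xs) ≡ ∑ (f ∘ g) xs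
∑-map f g xs = cong sum (sym (map-∘ xs))

∑-cong : {f g : A → ℕ} → f ≗ g → (xs : List A) → ∑ f xs ≡ ∑ g xs
∑-cong f≗g xs = cong sum (map-cong f≗g xs)

∑-zero : (xs : List A) → ∑ (λ _ → 0) xs ≡ 0
∑-zero []       = refl
∑-zero (_ ∷ xs) = ∑-zero xs

∑-+ : (f g : A → ℕ) (xs : List A) → ∑ (λ x → f x + g x) xs ≡ ∑ f xs + ∑ g xs
∑-+ f g []       = refl
∑-+ f g (x ∷ xs) =
  trans (cong (f x + g x +_) (∑-+ f g xs)) (+-interchange (f x) (g x) (∑ f xs) (∑ g xs))

∑-comm : (f : A → B → ℕ) (xs : List A) (ys : List B) →
         ∑ (λ x → ∑ (f x) ys) xs ≡ ∑ (λ y → ∑ (λ x → f x y) xs) ys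
∑-comm f []       ys = sym (∑-zero ys)
∑-comm f (x ∷ xs) ys =
  trans (cong (∑ (f x) ys +_) (∑-comm f xs ys)) (sym (∑-+ (f x) _ ys))

∑-concatMap : (f : B → ℕ) (g : A → List B) (xs : List A) →
              ∑ f (concatMap g xs) ≡ ∑ (λ x → ∑ f (g x)) xs
∑-concatMap f g []       = refl
∑-concatMap f g (x ∷ xs) =
  trans (∑-++ f (g x) (concatMap g xs)) (cong (∑ f (g x) +_) (∑-concatMap f g xs))

∑-filter : {P : Pred A 0ℓ} (P? : Decidable P) (f : A → ℕ) (xs : List A) →
           ∑ f (filter P? xs) ≡ ∑ (λ x → if does (P? x) then f x else 0) xs
∑-filter P? f []       = refl
∑-filter P? f (x ∷ xs) with does (P? x)
... | true  = cong (f x +_) (∑-filter P? f xs)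
... | false = ∑-filter P? f xs

length-filter≡∑𝟙 : {P : Pred A 0ℓ} (P? : Decidable P) (xs : List A) →
                    length (filter P? xs) ≡ ∑ (𝟙 P?) xs
length-filter≡∑𝟙 P? []       = refl
length-filter≡∑𝟙 P? (x ∷ xs) with does (P? x)
... | true  = cong suc (length-filter≡∑𝟙 P? xs)
... | false = length-filter≡∑𝟙 P? xs

-- Counting faces

∑𝟙-subsets-of-length : (j : ℕ) (xs : List A) →
                       ∑ (𝟙 (λ ys → length ys ≟ j)) (subsets xs) ≡ length xs C j
∑𝟙-subsets-of-length zero    []       = refl
∑𝟙-subsets-of-length (suc j) []       = refl
∑𝟙-subsets-of-length j       (x ∷ xs) = begin
    ∑ (𝟙 (λ ys → length ys ≟ j)) (subsets xs ++ map (x ∷_) (subsets xs))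
      ≡⟨ ∑-++ _ (subsets xs) _ ⟩
    ∑ (𝟙 (λ ys → length ys ≟ j)) (subsets xs) + ∑ (𝟙 (λ ys → length ys ≟ j)) (map (x ∷_) (subsets xs))
      ≡⟨ cong₂ _+_ (∑𝟙-subsets-of-length j xs) (∑-map _ (x ∷_) (subsets xs)) ⟩
    length xs C j + ∑ (𝟙 (λ ys → suc (length ys) ≟ j)) (subsets xs)
      ≡⟨ pascal j ⟩
    suc (length xs) C j ∎
  where
  open ≡-Reasoning
  pascal : ∀ j → length xs C j + ∑ (𝟙 (λ ys → suc (length ys) ≟ j)) (subsets xs) ≡ suc (length xs) C j
  pascal zero    = cong suc (∑-zero (subsets xs))
  pascal (suc j) = trans (cong (length xs C suc j +_) (∑𝟙-subsets-of-length j xs))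
                         (trans (+-comm (length xs C suc j) _) (nCk+nC[k+1]≡[n+1]C[k+1] (length xs) j))

fCoeff≡∑-ascents : (s : List ℕ) (j : ℕ) → fCoeff s j ≡ ∑ (λ w → length (ascents w) C j) (Stirling s)
fCoeff≡∑-ascents s j = begin
    fCoeff s j
      ≡⟨ length-filter≡∑𝟙 _ (faces s) ⟩
    ∑ (𝟙 (λ F → length (proj₂ F) ≟ j)) (faces s)
      ≡⟨ ∑-concatMap _ (λ w → map (w ,_) (subsets (ascents w))) (Stirling s) ⟩
    ∑ (λ w → ∑ (𝟙 (λ F → length (proj₂ F) ≟ j)) (map (w ,_) (subsets (ascents w)))) (Stirling s)
      ≡⟨ ∑-cong faces-of (Stirling s) ⟩
    ∑ (λ w → length (ascents w) C j) (Stirling s) ∎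
  where
  open ≡-Reasoning
  faces-of : ∀ w → ∑ (𝟙 (λ F → length (proj₂ F) ≟ j)) (map (w ,_) (subsets (ascents w)))
                   ≡ length (ascents w) C j
  faces-of w = trans (∑-map _ (w ,_) (subsets (ascents w))) (∑𝟙-subsets-of-length j (ascents w))

-- Reversal of words

∑-allWords-∷ : (n N : ℕ) (f : Word → ℕ) →
               ∑ f (allWords n (suc N)) ≡ ∑ (λ a → ∑ (λ w → f (a ∷ w)) (allWords n N)) (letters n)
∑-allWords-∷ n N f = trans (∑-concatMap f (λ a → map (a ∷_) (allWords n N)) (letters n))
                           (∑-cong (λ a → ∑-map f (a ∷_) (allWords n N)) (letters n))

∑-allWords-∷ʳ : (n N : ℕ) (f : Word → ℕ) →
                ∑ f (allWords n (suc N)) ≡ ∑ (λ w → ∑ (λ a → f (w ++ [ a ])) (letters n)) (allWords n N)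
∑-allWords-∷ʳ n zero    f = trans (∑-allWords-∷ n zero f)
  (trans (∑-cong (λ a → +-identityʳ (f [ a ])) (letters n)) (sym (+-identityʳ _)))
∑-allWords-∷ʳ n (suc N) f = begin
    ∑ f (allWords n (suc (suc N)))
      ≡⟨ ∑-allWords-∷ n (suc N) f ⟩
    ∑ (λ a → ∑ (λ w → f (a ∷ w)) (allWords n (suc N))) (letters n)
      ≡⟨ ∑-cong (λ a → ∑-allWords-∷ʳ n N (λ w → f (a ∷ w))) (letters n) ⟩
    ∑ (λ a → ∑ (λ w → ∑ (λ b → f (a ∷ w ++ [ b ])) (letters n)) (allWords n N)) (letters n)
      ≡⟨ ∑-allWords-∷ n N _ ⟨
    ∑ (λ w → ∑ (λ b → f (w ++ [ b ])) (letters n)) (allWords n (suc N)) ∎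
  where open ≡-Reasoning

∑-allWords-reverse : (n N : ℕ) (f : Word → ℕ) → ∑ f (allWords n N) ≡ ∑ (f ∘ reverse) (allWords n N)
∑-allWords-reverse n zero    f = refl
∑-allWords-reverse n (suc N) f = begin
    ∑ f (allWords n (suc N))
      ≡⟨ ∑-allWords-∷ n N f ⟩
    ∑ (λ a → ∑ (λ w → f (a ∷ w)) (allWords n N)) (letters n)
      ≡⟨ ∑-cong (λ a → ∑-allWords-reverse n N (λ w → f (a ∷ w))) (letters n) ⟩
    ∑ (λ a → ∑ (λ w → f (a ∷ reverse w)) (allWords n N)) (letters n)
      ≡⟨ ∑-comm (λ a w → f (a ∷ reverse w)) (letters n) (allWords n N) ⟩
    ∑ (λ w → ∑ (λ a → f (a ∷ reverse w)) (letters n)) (allWords n N)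
      ≡⟨ ∑-cong (λ w → ∑-cong (λ a → cong f (sym (reverse-++ w [ a ]))) (letters n)) (allWords n N) ⟩
    ∑ (λ w → ∑ (λ a → f (reverse (w ++ [ a ]))) (letters n)) (allWords n N)
      ≡⟨ ∑-allWords-∷ʳ n N (f ∘ reverse) ⟨
    ∑ (f ∘ reverse) (allWords n (suc N)) ∎
  where open ≡-Reasoning

∑-filter-allWords-reverse : {P : Pred Word 0ℓ} (P? : Decidable P) →
                            (∀ w → does (P? (reverse w)) ≡ does (P? w)) → (n N : ℕ) (f : Word → ℕ) →
                            ∑ f (filter P? (allWords n N)) ≡ ∑ (f ∘ reverse) (filter P? (allWords n N))
∑-filter-allWords-reverse P? P-reverse n N f = begin
    ∑ f (filter P? (allWords n N))
      ≡⟨ ∑-filter P? f (allWords n N) ⟩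
    ∑ (λ w → if does (P? w) then f w else 0) (allWords n N)
      ≡⟨ ∑-allWords-reverse n N _ ⟩
    ∑ (λ w → if does (P? (reverse w)) then f (reverse w) else 0) (allWords n N)
      ≡⟨ ∑-cong (λ w → cong (λ b → if b then f (reverse w) else 0) (P-reverse w)) (allWords n N) ⟩
    ∑ (λ w → if does (P? w) then f (reverse w) else 0) (allWords n N)
      ≡⟨ ∑-filter P? (f ∘ reverse) (allWords n N) ⟨
    ∑ (f ∘ reverse) (filter P? (allWords n N)) ∎
  where open ≡-Reasoning

T-⇔→≡ : {a b : Bool} → T a ⇔ T b → a ≡ b
T-⇔→≡ {false} {false} _   = refl
T-⇔→≡ {false} {true}  a⇔b = ⊥-elim (Equivalence.from a⇔b _)
T-⇔→≡ {true}  {false} a⇔b = ⊥-elim (Equivalence.to a⇔b _)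
T-⇔→≡ {true}  {true}  _   = refl

elemᵇ⇒∈ : ∀ {x} ys → T (elemᵇ x ys) → x ∈ ys
elemᵇ⇒∈ {x} (y ∷ ys) h with Equivalence.to T-∨ h
... | inj₁ x≡ᵇy    = here (≡ᵇ⇒≡ x y x≡ᵇy)
... | inj₂ h′      = there (elemᵇ⇒∈ ys h′)

∈⇒elemᵇ : ∀ {x ys} → x ∈ ys → T (elemᵇ x ys)
∈⇒elemᵇ {x} (here refl)  = Equivalence.from T-∨ (inj₁ (≡⇒≡ᵇ x x refl))
∈⇒elemᵇ     (there x∈ys) = Equivalence.from T-∨ (inj₂ (∈⇒elemᵇ x∈ys))

bigThen⇒⊆ : ∀ {x} ys → T (bigThen x ys) → ∃[ c ] x < c × c ∷ x ∷ [] ⊆ ys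
bigThen⇒⊆ {x} (y ∷ ys) h with Equivalence.to T-∨ h
... | inj₁ h₁ = let x<ᵇy , x∈ys = Equivalence.to T-∧ h₁
                in y , <ᵇ⇒< x y x<ᵇy , refl ∷ from∈ (elemᵇ⇒∈ ys x∈ys)
... | inj₂ h₂ = let c , x<c , cx⊆ys = bigThen⇒⊆ ys h₂ in c , x<c , y ∷ʳ cx⊆ys

⊆⇒bigThen : ∀ {x c} ys → x < c → c ∷ x ∷ [] ⊆ ys → T (bigThen x ys)
⊆⇒bigThen (y ∷ ys) x<c (.y ∷ʳ cx⊆ys) = Equivalence.from T-∨ (inj₂ (⊆⇒bigThen ys x<c cx⊆ys))
⊆⇒bigThen (y ∷ ys) x<c (refl ∷ x⊆ys) =
  Equivalence.from T-∨ (inj₁ (Equivalence.from T-∧ (<⇒<ᵇ x<c , ∈⇒elemᵇ (to∈ x⊆ys))))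

Has121 : Word → Set
Has121 w = ∃₂ λ a c → a < c × a ∷ c ∷ a ∷ [] ⊆ w

contains121⇒Has121 : ∀ w → T (contains121 w) → Has121 w
contains121⇒Has121 (x ∷ xs) h with Equivalence.to T-∨ h
... | inj₁ h₁ = let c , x<c , cx⊆xs = bigThen⇒⊆ xs h₁ in x , c , x<c , refl ∷ cx⊆xs
... | inj₂ h₂ = let a , c , a<c , aca⊆xs = contains121⇒Has121 xs h₂ in a , c , a<c , x ∷ʳ aca⊆xs

Has121⇒contains121 : ∀ w → Has121 w → T (contains121 w)
Has121⇒contains121 (x ∷ xs) (a , c , a<c , .x ∷ʳ aca⊆xs) =
  Equivalence.from T-∨ (inj₂ (Has121⇒contains121 xs (a , c , a<c , aca⊆xs)))
Has121⇒contains121 (x ∷ xs) (a , c , a<c , refl ∷ ca⊆xs) =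
  Equivalence.from T-∨ (inj₁ (⊆⇒bigThen xs a<c ca⊆xs))

-- The pattern 121 is a palindrome.
contains121-reverse : ∀ w → contains121 (reverse w) ≡ contains121 w
contains121-reverse w = T-⇔→≡ (mk⇔
  (λ h → let a , c , a<c , τ = contains121⇒Has121 (reverse w) h
         in Has121⇒contains121 w (a , c , a<c , reverse⁻ τ))
  (λ h → let a , c , a<c , τ = contains121⇒Has121 w h
         in Has121⇒contains121 (reverse w) (a , c , a<c , reverse⁺ τ)))

occ-++ : ∀ a xs ys → occ a (xs ++ ys) ≡ occ a xs + occ a ys
occ-++ a []       ys = refl
occ-++ a (x ∷ xs) ys with a ≡ᵇ x
... | true  = cong suc (occ-++ a xs ys)
... | false = occ-++ a xs ys

occ-reverse : ∀ a w → occ a (reverse w) ≡ occ a w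
occ-reverse a []      = refl
occ-reverse a (x ∷ w) = begin
    occ a (reverse (x ∷ w))         ≡⟨ cong (occ a) (unfold-reverse x w) ⟩
    occ a (reverse w ++ [ x ])      ≡⟨ occ-++ a (reverse w) [ x ] ⟩
    occ a (reverse w) + occ a [ x ] ≡⟨ cong (_+ occ a [ x ]) (occ-reverse a w) ⟩
    occ a w + occ a [ x ]           ≡⟨ +-comm (occ a w) (occ a [ x ]) ⟩
    occ a [ x ] + occ a w           ≡⟨ occ-++ a [ x ] w ⟨
    occ a (x ∷ w)                   ∎
  where open ≡-Reasoning

multOK-reverse : ∀ i s w → multOK i s (reverse w) ≡ multOK i s w
multOK-reverse i []       w = refl
multOK-reverse i (m ∷ ms) w =
  cong₂ (λ k b → (k ≡ᵇ m) ∧ b) (occ-reverse i w) (multOK-reverse (suc i) ms w)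

isStirling-reverse : ∀ s w → isStirling s (reverse w) ≡ isStirling s w
isStirling-reverse s w =
  cong₂ (λ b c → b ∧ not c) (multOK-reverse 1 s w) (contains121-reverse w)

∑-Stirling-reverse : (s : List ℕ) (f : Word → ℕ) → ∑ f (Stirling s) ≡ ∑ (f ∘ reverse) (Stirling s)
∑-Stirling-reverse s = ∑-filter-allWords-reverse stirling?
  (λ w → cong (λ b → does (b Bool.≟ true)) (isStirling-reverse s w)) (length s) (sum s)
  where
  stirling? : (w : Word) → Dec (isStirling s w ≡ true)
  stirling? w = isStirling s w Bool.≟ true

adjacentPairs : List A → List (A × A)
adjacentPairs []           = []
adjacentPairs (x ∷ [])     = []
adjacentPairs (x ∷ y ∷ ys) = (x , y) ∷ adjacentPairs (y ∷ ys)

adjacentPairs-++ : (xs : List A) (a : A) (ys : List A) →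
                   adjacentPairs (xs ++ a ∷ ys) ≡ adjacentPairs (xs ++ [ a ]) ++ adjacentPairs (a ∷ ys)
adjacentPairs-++ []           a ys = refl
adjacentPairs-++ (x ∷ [])     a ys = refl
adjacentPairs-++ (x ∷ y ∷ xs) a ys = cong ((x , y) ∷_) (adjacentPairs-++ (y ∷ xs) a ys)

adjacentPairs-reverse : (xs : List A) → adjacentPairs (reverse xs) ≡ reverse (map swap (adjacentPairs xs))
adjacentPairs-reverse []           = refl
adjacentPairs-reverse (x ∷ [])     = refl
adjacentPairs-reverse (x ∷ y ∷ ys) = begin
    adjacentPairs (reverse (x ∷ y ∷ ys))
      ≡⟨ cong adjacentPairs (reverse-++ (x ∷ y ∷ []) ys) ⟩
    adjacentPairs (reverse ys ++ y ∷ x ∷ [])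
      ≡⟨ adjacentPairs-++ (reverse ys) y (x ∷ []) ⟩
    adjacentPairs (reverse ys ++ [ y ]) ++ [ (y , x) ]
      ≡⟨ cong (λ zs → adjacentPairs zs ++ [ (y , x) ]) (unfold-reverse y ys) ⟨
    adjacentPairs (reverse (y ∷ ys)) ++ [ (y , x) ]
      ≡⟨ cong (_++ [ (y , x) ]) (adjacentPairs-reverse (y ∷ ys)) ⟩
    reverse (map swap (adjacentPairs (y ∷ ys))) ++ [ (y , x) ]
      ≡⟨ unfold-reverse (y , x) (map swap (adjacentPairs (y ∷ ys))) ⟨
    reverse (map swap (adjacentPairs (x ∷ y ∷ ys))) ∎
  where open ≡-Reasoning

length-adjacentPairs : (xs : List A) → length (adjacentPairs xs) ≡ pred (length xs)
length-adjacentPairs []           = refl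
length-adjacentPairs (x ∷ [])     = refl
length-adjacentPairs (x ∷ y ∷ ys) = cong suc (length-adjacentPairs (y ∷ ys))

filter-reverse : {P : Pred A 0ℓ} (P? : Decidable P) (xs : List A) →
                 filter P? (reverse xs) ≡ reverse (filter P? xs)
filter-reverse P? []       = refl
filter-reverse P? (x ∷ xs) = begin
    filter P? (reverse (x ∷ xs))
      ≡⟨ cong (filter P?) (unfold-reverse x xs) ⟩
    filter P? (reverse xs ++ [ x ])
      ≡⟨ filter-++ P? (reverse xs) [ x ] ⟩
    filter P? (reverse xs) ++ filter P? [ x ]
      ≡⟨ cong₂ _++_ (filter-reverse P? xs) filter-singleton ⟩
    reverse (filter P? xs) ++ reverse (filter P? [ x ])
      ≡⟨ reverse-++ (filter P? [ x ]) (filter P? xs) ⟨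
    reverse (filter P? [ x ] ++ filter P? xs)
      ≡⟨ cong reverse (filter-++ P? [ x ] xs) ⟨
    reverse (filter P? (x ∷ xs)) ∎
  where
  open ≡-Reasoning
  filter-singleton : filter P? [ x ] ≡ reverse (filter P? [ x ])
  filter-singleton with does (P? x)
  ... | true  = refl
  ... | false = refl

ascending? : (p : ℕ × ℕ) → Dec (proj₁ p < proj₂ p)
ascending? (x , y) = x <? y

-- does (x <? y) reduces to x <ᵇ y, so a single case split on x <ᵇ y evaluates both sides.
ascList≡filter-adjacentPairs : ∀ w → ascList w ≡ filter ascending? (adjacentPairs w)
ascList≡filter-adjacentPairs []           = refl
ascList≡filter-adjacentPairs (x ∷ [])     = refl
ascList≡filter-adjacentPairs (x ∷ y ∷ ys) with ih ← ascList≡filter-adjacentPairs (y ∷ ys) | x <ᵇ y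
... | true  = cong ((x , y) ∷_) ih
... | false = ih

descList≡filter-adjacentPairs : ∀ w → descList w ≡ filter ascending? (map swap (adjacentPairs w))
descList≡filter-adjacentPairs []           = refl
descList≡filter-adjacentPairs (x ∷ [])     = refl
descList≡filter-adjacentPairs (x ∷ y ∷ ys) with ih ← descList≡filter-adjacentPairs (y ∷ ys) | y <ᵇ x
... | true  = cong ((y , x) ∷_) ih
... | false = ih

ascList-reverse : ∀ w → ascList (reverse w) ≡ reverse (descList w)
ascList-reverse w = begin
    ascList (reverse w)
      ≡⟨ ascList≡filter-adjacentPairs (reverse w) ⟩
    filter ascending? (adjacentPairs (reverse w))
      ≡⟨ cong (filter ascending?) (adjacentPairs-reverse w) ⟩
    filter ascending? (reverse (map swap (adjacentPairs w)))
      ≡⟨ filter-reverse ascending? (map swap (adjacentPairs w)) ⟩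
    reverse (filter ascending? (map swap (adjacentPairs w)))
      ≡⟨ cong reverse (descList≡filter-adjacentPairs w) ⟨
    reverse (descList w) ∎
  where open ≡-Reasoning

pairEq⇒≡ : ∀ p q → T (pairEq p q) → p ≡ q
pairEq⇒≡ (a , b) (c , d) h =
  let a≡ᵇc , b≡ᵇd = Equivalence.to T-∧ h in cong₂ _,_ (≡ᵇ⇒≡ a c a≡ᵇc) (≡ᵇ⇒≡ b d b≡ᵇd)

pairEq-≢ : ∀ {p q} → p ≢ q → pairEq p q ≡ false
pairEq-≢ p≢q = ¬-not (p≢q ∘ pairEq⇒≡ _ _ ∘ Equivalence.from T-≡)

memPair-↭ : ∀ p {xs ys} → xs ↭ ys → memPair p xs ≡ memPair p ys
memPair-↭ p ↭.refl                       = refl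
memPair-↭ p (↭.prep x xs↭ys)             = cong (pairEq p x ∨_) (memPair-↭ p xs↭ys)
memPair-↭ p (↭.swap {ys = ys} x y xs↭ys) =
  trans (cong (λ b → pairEq p x ∨ (pairEq p y ∨ b)) (memPair-↭ p xs↭ys))
        (∨-leftComm (pairEq p x) (pairEq p y) (memPair p ys))
memPair-↭ p (↭.trans xs↭ys ys↭zs)        = trans (memPair-↭ p xs↭ys) (memPair-↭ p ys↭zs)

isNew : Bool → ℕ
isNew b = if b then 0 else 1

length-dedup-∷ : ∀ p ps → length (dedup (p ∷ ps)) ≡ isNew (memPair p ps) + length (dedup ps)
length-dedup-∷ p ps with memPair p ps
... | true  = refl
... | false = refl

length-dedup-∷-cong : ∀ p {xs ys} → xs ↭ ys → length (dedup xs) ≡ length (dedup ys) →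
                      length (dedup (p ∷ xs)) ≡ length (dedup (p ∷ ys))
length-dedup-∷-cong p {xs} {ys} xs↭ys eq = begin
    length (dedup (p ∷ xs))                 ≡⟨ length-dedup-∷ p xs ⟩
    isNew (memPair p xs) + length (dedup xs) ≡⟨ cong₂ _+_ (cong isNew (memPair-↭ p xs↭ys)) eq ⟩
    isNew (memPair p ys) + length (dedup ys) ≡⟨ length-dedup-∷ p ys ⟨
    length (dedup (p ∷ ys))                 ∎
  where open ≡-Reasoning

length-dedup-swap : ∀ x y zs → length (dedup (x ∷ y ∷ zs)) ≡ length (dedup (y ∷ x ∷ zs))
length-dedup-swap x y zs with Product.≡-dec _≟_ _≟_ x y
... | yes refl = refl
... | no x≢y   = begin
    length (dedup (x ∷ y ∷ zs))
      ≡⟨ length-dedup-∷ x (y ∷ zs) ⟩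
    isNew (pairEq x y ∨ memPair x zs) + length (dedup (y ∷ zs))
      ≡⟨ cong₂ _+_ (cong (λ b → isNew (b ∨ memPair x zs)) (pairEq-≢ x≢y)) (length-dedup-∷ y zs) ⟩
    isNew (memPair x zs) + (isNew (memPair y zs) + length (dedup zs))
      ≡⟨ +-leftComm (isNew (memPair x zs)) (isNew (memPair y zs)) (length (dedup zs)) ⟩
    isNew (memPair y zs) + (isNew (memPair x zs) + length (dedup zs))
      ≡⟨ cong₂ _+_ (cong (λ b → isNew (b ∨ memPair y zs)) (pairEq-≢ (x≢y ∘ sym))) (length-dedup-∷ x zs) ⟨
    isNew (pairEq y x ∨ memPair y zs) + length (dedup (x ∷ zs))
      ≡⟨ length-dedup-∷ y (x ∷ zs) ⟨
    length (dedup (y ∷ x ∷ zs)) ∎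
  where open ≡-Reasoning

length-dedup-↭ : ∀ {xs ys} → xs ↭ ys → length (dedup xs) ≡ length (dedup ys)
length-dedup-↭ ↭.refl                  = refl
length-dedup-↭ (↭.prep x xs↭ys)        = length-dedup-∷-cong x xs↭ys (length-dedup-↭ xs↭ys)
length-dedup-↭ (↭.swap {xs} x y xs↭ys) =
  trans (length-dedup-swap x y xs)
        (length-dedup-∷-cong y (↭.prep x xs↭ys) (length-dedup-∷-cong x xs↭ys (length-dedup-↭ xs↭ys)))
length-dedup-↭ (↭.trans xs↭ys ys↭zs)   = trans (length-dedup-↭ xs↭ys) (length-dedup-↭ ys↭zs)

length-dedup≤ : ∀ ps → length (dedup ps) ≤ length ps
length-dedup≤ []       = z≤n
length-dedup≤ (p ∷ ps) with memPair p ps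
... | true  = ≤-trans (length-dedup≤ ps) (n≤1+n _)
... | false = s≤s (length-dedup≤ ps)

length-ascents-reverse : ∀ w → length (ascents (reverse w)) ≡ length (descents w)
length-ascents-reverse w =
  trans (cong (length ∘ dedup) (ascList-reverse w)) (length-dedup-↭ (↭-reverse (descList w)))

-- Grouping by number of descents

∑-if-≟-∉ : ∀ {d ks} (g : ℕ → ℕ) → d ∉ ks → ∑ (λ k → if does (d ≟ k) then g k else 0) ks ≡ 0
∑-if-≟-∉         {ks = []}     g d∉ks = refl
∑-if-≟-∉ {d = d} {ks = k ∷ ks} g d∉ks =
  cong₂ _+_ (cong (λ b → if b then g k else 0) (dec-false (d ≟ k) (d∉ks ∘ here)))
            (∑-if-≟-∉ g (d∉ks ∘ there))

∑-if-≟-∈ : ∀ {d ks} (g : ℕ → ℕ) → Unique ks → d ∈ ks →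
           ∑ (λ k → if does (d ≟ k) then g k else 0) ks ≡ g d
∑-if-≟-∈ {d = d} {ks = k ∷ ks} g (k∉ks ∷ unique) d∈ks with d ≟ k
... | yes refl = trans (cong₂ _+_ (cong (λ b → if b then g d else 0) (dec-true (d ≟ d) refl))
                                 (∑-if-≟-∉ g (All¬⇒¬Any k∉ks)))
                       (+-identityʳ (g d))
... | no  d≢k  = cong₂ _+_ (cong (λ b → if b then g k else 0) (dec-false (d ≟ k) d≢k))
                           (∑-if-≟-∈ g unique (Any.tail d≢k d∈ks))

∑-fibres : (d : A → ℕ) (g : ℕ → ℕ) {m : ℕ} {xs : List A} → All (λ x → d x < m) xs →
           ∑ (λ k → length (filter (λ x → d x ≟ k) xs) * g k) (upTo m) ≡ ∑ (g ∘ d) xs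
∑-fibres d g {m} {[]}     []                 = ∑-zero (upTo m)
∑-fibres d g {m} {x ∷ xs} (dx<m ∷ bounded) = begin
    ∑ (λ k → length (filter (λ y → d y ≟ k) (x ∷ xs)) * g k) (upTo m)
      ≡⟨ ∑-cong fibres-∷ (upTo m) ⟩
    ∑ (λ k → at-dx k + fibres-xs k) (upTo m)
      ≡⟨ ∑-+ at-dx fibres-xs (upTo m) ⟩
    ∑ at-dx (upTo m) + ∑ fibres-xs (upTo m)
      ≡⟨ cong₂ _+_ (∑-if-≟-∈ g (upTo⁺ m) (∈-upTo⁺ dx<m)) (∑-fibres d g bounded) ⟩
    g (d x) + ∑ (g ∘ d) xs ∎
  where
  open ≡-Reasoning
  at-dx : ℕ → ℕ
  at-dx k = if does (d x ≟ k) then g k else 0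
  fibres-xs : ℕ → ℕ
  fibres-xs k = length (filter (λ y → d y ≟ k) xs) * g k
  fibres-∷ : ∀ k → length (filter (λ y → d y ≟ k) (x ∷ xs)) * g k ≡ at-dx k + fibres-xs k
  fibres-∷ k with does (d x ≟ k)
  ... | true  = refl
  ... | false = refl

length-descents≤ : ∀ w → length (descents w) ≤ length w
length-descents≤ w = begin
    length (dedup (descList w))
      ≤⟨ length-dedup≤ (descList w) ⟩
    length (descList w)
      ≡⟨ cong length (descList≡filter-adjacentPairs w) ⟩
    length (filter ascending? (map swap (adjacentPairs w)))
      ≤⟨ length-filter ascending? (map swap (adjacentPairs w)) ⟩
    length (map swap (adjacentPairs w))
      ≡⟨ length-map swap (adjacentPairs w) ⟩
    length (adjacentPairs w)
      ≡⟨ length-adjacentPairs w ⟩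
    pred (length w)
      ≤⟨ pred[n]≤n ⟩
    length w ∎
  where open ≤-Reasoning

allWords-length : ∀ n N → All (λ w → length w ≡ N) (allWords n N)
allWords-length n zero    = refl ∷ []
allWords-length n (suc N) =
  concat⁺ (map⁺ (All.universal (λ _ → map⁺ (All.map (cong suc) (allWords-length n N))) (letters n)))

descents-bounded : ∀ s → All (λ w → length (descents w) < suc (sum s)) (Stirling s)
descents-bounded s = All.map (λ {w} |w|≡ → s≤s (≤-trans (length-descents≤ w) (≤-reflexive |w|≡)))
                             (filter⁺ _ (allWords-length (length s) (sum s)))

proposition3p20 : (s : List ℕ) → IsComposition s → (j : ℕ) →
    fCoeff s j ≡ sum (map (λ k → length (W s k) * (k C j)) (upTo (suc (sum s))))
proposition3p20 s _ j = begin
    fCoeff s j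
      ≡⟨ fCoeff≡∑-ascents s j ⟩
    ∑ (λ w → length (ascents w) C j) (Stirling s)
      ≡⟨ ∑-Stirling-reverse s (λ w → length (ascents w) C j) ⟩
    ∑ (λ w → length (ascents (reverse w)) C j) (Stirling s)
      ≡⟨ ∑-cong (λ w → cong (_C j) (length-ascents-reverse w)) (Stirling s) ⟩
    ∑ (λ w → length (descents w) C j) (Stirling s)
      ≡⟨ ∑-fibres (length ∘ descents) (_C j) (descents-bounded s) ⟨
    ∑ (λ k → length (W s k) * (k C j)) (upTo (suc (sum s))) ∎
  where open ≡-Reasoning
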